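{- For all $n\ge 6$, every vertex of the graph $G(3,n)$ lies on a $4$-cycle.
   Context: For a prime $p$ and $n\in\mathbb{N}$, $G(p,n)$ is the simple graph with vertex set $\{2,4,\ldots,2n\}$ in which two distinct vertices $a,b$ are adjacent if and only if both $\frac{a+b}{2}$ and $\frac{|a-b|}{2}$ are odd positive integers neither of which equals $pk$ for an integer $k\ge 2$. -}

module Defs where

open import Data.Nat using (ℕ; zero; suc; _+_; _*_; _≤_; _<_; ∣_-_∣)
open import Data.Nat.DivMod using (_/_)
open import Data.Nat.Primality using (Prime)
open import Data.Product using (Σ; _×_; ∃-syntax)
open import Relation.Binary.PropositionalEquality using (_≡_; _≢_)
open import Relation.Nullary using (¬_)

Odd : ℕ → Set
Odd m = ∃[ k ] (m ≡ suc (2 * k))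

BadMultiple : ℕ → ℕ → Set
BadMultiple p m = ∃[ k ] ((2 ≤ k) × (m ≡ p * k))

Good : ℕ → ℕ → Set
Good p m = Odd m × (0 < m) × ¬ BadMultiple p m

IsVertex : ℕ → ℕ → Set
IsVertex n v = ∃[ i ] ((1 ≤ i) × (i ≤ n) × (v ≡ 2 * i))

Adj : ℕ → ℕ → ℕ → Set
Adj p a b = (a ≢ b) × Good p ((a + b) / 2) × Good p (∣ a - b ∣ / 2)

OnFourCycle : ℕ → ℕ → ℕ → Set
OnFourCycle p n v =
  ∃[ w ] ∃[ x ] ∃[ y ]
    (IsVertex n w × IsVertex n x × IsVertex n y
    × v ≢ w × v ≢ x × v ≢ y × w ≢ x × w ≢ y × x ≢ y
    × Adj p v w × Adj p w x × Adj p x y × Adj p y v)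

{-# OPTIONS --safe #-}
module Submission where

-- Halving the vertex labels, 2i and 2j are adjacent iff i + j and ∣ i - j ∣ are good.
-- For i ≤ 6 the 4-cycles 1-2-3-4 and 1-2-5-6 contain i.  For i = 7, 8, 9 the 4-cycles
-- 7-4-1-6, 8-3-2-5 and 9-2-3-4 lie below i and all their edge sums are odd and prime to 3.
-- Adding 3 to every vertex keeps the differences and adds 6 to the sums, so it maps such
-- a cycle to another one, and by induction every i ≥ 7 lies on a 4-cycle below i.
-- Staying below i is what keeps every vertex inside {2, 4, …, 2n}.

open import Defs
open import Data.Nat using (ℕ; zero; suc; _+_; _*_; _≤_; ∣_-_∣; z≤n; s≤s; NonZero; _≟_; _≤?_; _<?_)
open import Data.Nat.Properties
open import Data.Nat.DivMod using (_/_; m*n/n≡m)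
open import Data.Nat.Divisibility using (_∣_; divides; _∣?_; ∣m+n∣m⇒∣n; n∣m*n; m∣m*n)
open import Data.Nat.Tactic.RingSolver using (solve-∀)
open import Data.Product using (_×_; _,_; proj₁; ∃-syntax)
open import Function using (id; _∘_)
open import Function.Definitions using (Injective)
open import Level using (0ℓ)
open import Relation.Binary.Core using (Rel; _⇒_; _=[_]⇒_)
open import Relation.Binary.Definitions using (Decidable)
open import Relation.Binary.PropositionalEquality using (_≡_; _≢_; refl; sym; trans; cong; subst; ≢-sym)
open import Relation.Nullary using (Dec; yes; no; ¬_; ¬?; _×-dec_)
open import Relation.Nullary.Decidable using (map′; True; toWitness)
open import Relation.Unary using (Pred) renaming (Decidable to Decidable₁)

variable
  p m n i j s : ℕ
  R S : Rel ℕ 0ℓ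
  P Q : Pred ℕ 0ℓ

odd-2+ : Odd m → Odd (2 + m)
odd-2+ (k , refl) = suc k , cong suc (sym (*-suc 2 k))

odd-2+⁻¹ : Odd (2 + m) → Odd m
odd-2+⁻¹ (suc k , eq) = k , suc-injective (suc-injective (trans eq (cong suc (*-suc 2 k))))

odd? : Decidable₁ Odd
odd? zero = no λ ()
odd? (suc zero) = yes (0 , refl)
odd? (suc (suc m)) = map′ odd-2+ odd-2+⁻¹ (odd? m)

badMultiple⇒∣×≤ : BadMultiple p m → p ∣ m × 2 * p ≤ m
badMultiple⇒∣×≤ {p} (k , 2≤k , refl) = m∣m*n k , subst (_≤ p * k) (*-comm p 2) (*-monoʳ-≤ p 2≤k)

∣×≤⇒badMultiple : .{{NonZero p}} → p ∣ m × 2 * p ≤ m → BadMultiple p m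
∣×≤⇒badMultiple {p} (divides k refl , 2p≤kp) = k , *-cancelʳ-≤ 2 k p 2p≤kp , *-comm k p

badMultiple? : ∀ p .{{_ : NonZero p}} → Decidable₁ (BadMultiple p)
badMultiple? p m = map′ ∣×≤⇒badMultiple badMultiple⇒∣×≤ (p ∣? m ×-dec 2 * p ≤? m)

good? : ∀ p .{{_ : NonZero p}} → Decidable₁ (Good p)
good? p m = odd? m ×-dec 0 <? m ×-dec ¬? (badMultiple? p m)

OddNonMultiple : ℕ → Pred ℕ 0ℓ
OddNonMultiple p s = Odd s × ¬ p ∣ s

oddNonMultiple? : ∀ p → Decidable₁ (OddNonMultiple p)
oddNonMultiple? p s = odd? s ×-dec ¬? (p ∣? s)

oddNonMultiple⇒good : OddNonMultiple p s → Good p s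
oddNonMultiple⇒good {p} (odd@(_ , refl) , p∤s) = odd , s≤s z≤n , λ (k , _ , eq) → p∤s (subst (p ∣_) (sym eq) (m∣m*n k))

oddNonMultiple-2p+ : OddNonMultiple p s → OddNonMultiple p (2 * p + s)
oddNonMultiple-2p+ {p} ((k , refl) , p∤s) =
  (p + k , trans (+-suc (2 * p) (2 * k)) (cong suc (sym (*-distribˡ-+ 2 p k)))) ,
  λ p∣2p+s → p∤s (∣m+n∣m⇒∣n p∣2p+s (n∣m*n 2))

record SumDiff (S D : Pred ℕ 0ℓ) (i j : ℕ) : Set where
  constructor _,_
  field
    sum : S (i + j)
    diff : D ∣ i - j ∣

sumDiff? : Decidable₁ P → Decidable₁ Q → Decidable (SumDiff P Q)
sumDiff? P? Q? i j = map′ (λ (s , d) → s , d) (λ (s , d) → s , d) (P? (i + j) ×-dec Q? ∣ i - j ∣)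

IndexAdj : ℕ → Rel ℕ 0ℓ
IndexAdj p = SumDiff (Good p) (Good p)

-- Unlike goodness itself, the sum condition here survives adding 2p to the sum.
PeriodicAdj : ℕ → Rel ℕ 0ℓ
PeriodicAdj p = SumDiff (OddNonMultiple p) (Good p)

indexAdj? : ∀ p .{{_ : NonZero p}} → Decidable (IndexAdj p)
indexAdj? p = sumDiff? (good? p) (good? p)

periodicAdj? : ∀ p .{{_ : NonZero p}} → Decidable (PeriodicAdj p)
periodicAdj? p = sumDiff? (oddNonMultiple? p) (good? p)

indexAdj⇒≢ : IndexAdj p i j → i ≢ j
indexAdj⇒≢ {i = i} (_ , (_ , 0<∣i-i∣ , _)) refl = <-irrefl (sym (∣n-n∣≡0 i)) 0<∣i-i∣

half-double : ∀ m → 2 * m / 2 ≡ m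
half-double m = trans (cong (_/ 2) (*-comm 2 m)) (m*n/n≡m m 2)

indexAdj-double : IndexAdj p =[ 2 *_ ]⇒ Adj p
indexAdj-double {p} {i} {j} adj@(sum , diff) =
  indexAdj⇒≢ {p} adj ∘ *-cancelˡ-≡ i j 2 ,
  subst (Good p) (sym half-sum) sum ,
  subst (Good p) (sym half-diff) diff
  where
  half-sum : (2 * i + 2 * j) / 2 ≡ i + j
  half-sum = trans (cong (_/ 2) (sym (*-distribˡ-+ 2 i j))) (half-double (i + j))

  half-diff : ∣ 2 * i - 2 * j ∣ / 2 ≡ ∣ i - j ∣
  half-diff = trans (cong (_/ 2) (sym (*-distribˡ-∣-∣ 2 i j))) (half-double ∣ i - j ∣)

periodicAdj⇒indexAdj : PeriodicAdj p ⇒ IndexAdj p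
periodicAdj⇒indexAdj (sum , diff) = oddNonMultiple⇒good sum , diff

periodicAdj-shift : PeriodicAdj p =[ p +_ ]⇒ PeriodicAdj p
periodicAdj-shift {p} {i} {j} (sum , diff) =
  subst (OddNonMultiple p) (sym (sum-shift p i j)) (oddNonMultiple-2p+ sum) ,
  subst (Good p) (sym (∣m+n-m+o∣≡∣n-o∣ p i j)) diff
  where
  sum-shift : ∀ p i j → p + i + (p + j) ≡ 2 * p + (i + j)
  sum-shift = solve-∀

-- Only targets are constrained: on a cycle every vertex is the target of some edge.
record _↾_ (R : Rel ℕ 0ℓ) (P : Pred ℕ 0ℓ) (i j : ℕ) : Set where
  constructor _,_
  field
    edge : R i j
    target : P j

_↾?_ : Decidable R → Decidable₁ P → Decidable (R ↾ P)
(R? ↾? P?) i j = map′ (λ (r , pj) → r , pj) (λ (r , pj) → r , pj) (R? i j ×-dec P? j)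

↾-map : ∀ {f} → R =[ f ]⇒ S → (∀ {j} → P j → Q (f j)) → (R ↾ P) =[ f ]⇒ (S ↾ Q)
↾-map R⇒S P⇒Q (r , pj) = R⇒S r , P⇒Q pj

Index : ℕ → Pred ℕ 0ℓ
Index n j = 1 ≤ j × j ≤ n

index? : ∀ n → Decidable₁ (Index n)
index? n j = 1 ≤? j ×-dec j ≤? n

index-mono : m ≤ n → Index m j → Index n j
index-mono m≤n (1≤j , j≤m) = 1≤j , ≤-trans j≤m m≤n

index-shift : ∀ k → Index n j → Index (k + n) (k + j)
index-shift {j = j} k (1≤j , j≤n) = ≤-trans 1≤j (m≤n+m j k) , +-monoʳ-≤ k j≤n

index⇒isVertex : Index n j → IsVertex n (2 * j)
index⇒isVertex (1≤j , j≤n) = _ , 1≤j , j≤n , refl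

Cycle₄ : Rel ℕ 0ℓ → ℕ → ℕ → ℕ → ℕ → Set
Cycle₄ R a b c d = a ≢ c × b ≢ d × R a b × R b c × R c d × R d a

OnCycle₄ : Rel ℕ 0ℓ → Pred ℕ 0ℓ
OnCycle₄ R a = ∃[ b ] ∃[ c ] ∃[ d ] Cycle₄ R a b c d

cycle₄? : Decidable R → ∀ a b c d → Dec (Cycle₄ R a b c d)
cycle₄? R? a b c d = ¬? (a ≟ c) ×-dec ¬? (b ≟ d) ×-dec R? a b ×-dec R? b c ×-dec R? c d ×-dec R? d a

onCycle₄-check : (R? : Decidable R) → ∀ a b c d → {True (cycle₄? R? a b c d)} → OnCycle₄ R a
onCycle₄-check R? a b c d {ok} = b , c , d , toWitness ok

onCycle₄-map : ∀ {a} (f : ℕ → ℕ) → Injective _≡_ _≡_ f → R =[ f ]⇒ S → OnCycle₄ R a → OnCycle₄ S (f a)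
onCycle₄-map f f-inj R⇒S (b , c , d , a≢c , b≢d , ab , bc , cd , da) =
  f b , f c , f d , a≢c ∘ f-inj , b≢d ∘ f-inj , R⇒S ab , R⇒S bc , R⇒S cd , R⇒S da

onCycle₄-weaken : ∀ {a} → R ⇒ S → OnCycle₄ R a → OnCycle₄ S a
onCycle₄-weaken = onCycle₄-map id id

onCycle₄-index-mono : m ≤ n → OnCycle₄ (R ↾ Index m) i → OnCycle₄ (R ↾ Index n) i
onCycle₄-index-mono m≤n = onCycle₄-weaken (↾-map id (index-mono m≤n))

onCycle₄⇒OnFourCycle : ∀ {v} → OnCycle₄ (Adj p ↾ IsVertex n) v → OnFourCycle p n v
onCycle₄⇒OnFourCycle (w , x , y , v≢x , w≢y , (vw , w∈) , (wx , x∈) , (xy , y∈) , (yv , _)) =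
  w , x , y , w∈ , x∈ , y∈ , proj₁ vw , v≢x , ≢-sym (proj₁ yv) , proj₁ wx , w≢y , proj₁ xy ,
  vw , wx , xy , yv

periodic-onCycle₄ : ∀ j → OnCycle₄ (PeriodicAdj 3 ↾ Index (7 + j)) (7 + j)
periodic-onCycle₄ 0 = onCycle₄-check (periodicAdj? 3 ↾? index? 7) 7 4 1 6
periodic-onCycle₄ 1 = onCycle₄-check (periodicAdj? 3 ↾? index? 8) 8 3 2 5
periodic-onCycle₄ 2 = onCycle₄-check (periodicAdj? 3 ↾? index? 9) 9 2 3 4
periodic-onCycle₄ (suc (suc (suc j))) =
  onCycle₄-map (3 +_) (+-cancelˡ-≡ 3 _ _) shift (periodic-onCycle₄ j)
  where
  shift : (PeriodicAdj 3 ↾ Index (7 + j)) =[ 3 +_ ]⇒ (PeriodicAdj 3 ↾ Index (10 + j))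
  shift = ↾-map periodicAdj-shift (index-shift 3)

index-onCycle₄ : 6 ≤ n → ∀ i → Index n i → OnCycle₄ (IndexAdj 3 ↾ Index n) i
index-onCycle₄ _ 0 (() , _)
index-onCycle₄ 6≤n 1 _ = onCycle₄-index-mono 6≤n (onCycle₄-check (indexAdj? 3 ↾? index? 6) 1 2 3 4)
index-onCycle₄ 6≤n 2 _ = onCycle₄-index-mono 6≤n (onCycle₄-check (indexAdj? 3 ↾? index? 6) 2 3 4 1)
index-onCycle₄ 6≤n 3 _ = onCycle₄-index-mono 6≤n (onCycle₄-check (indexAdj? 3 ↾? index? 6) 3 4 1 2)
index-onCycle₄ 6≤n 4 _ = onCycle₄-index-mono 6≤n (onCycle₄-check (indexAdj? 3 ↾? index? 6) 4 1 2 3)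
index-onCycle₄ 6≤n 5 _ = onCycle₄-index-mono 6≤n (onCycle₄-check (indexAdj? 3 ↾? index? 6) 5 6 1 2)
index-onCycle₄ 6≤n 6 _ = onCycle₄-index-mono 6≤n (onCycle₄-check (indexAdj? 3 ↾? index? 6) 6 1 2 5)
index-onCycle₄ _ (suc (suc (suc (suc (suc (suc (suc j))))))) (_ , i≤n) =
  onCycle₄-weaken (↾-map periodicAdj⇒indexAdj (index-mono i≤n)) (periodic-onCycle₄ j)

lemma4p3 : (n : ℕ) → 6 ≤ n → (v : ℕ) → IsVertex n v → OnFourCycle 3 n v
lemma4p3 n 6≤n v (i , 1≤i , i≤n , refl) =
  onCycle₄⇒OnFourCycle {p = 3}
    (onCycle₄-map (2 *_) (λ {x} {y} → *-cancelˡ-≡ x y 2) double (index-onCycle₄ 6≤n i (1≤i , i≤n)))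
  where
  double : (IndexAdj 3 ↾ Index n) =[ 2 *_ ]⇒ (Adj 3 ↾ IsVertex n)
  double (adj , j∈) = indexAdj-double {p = 3} adj , index⇒isVertex j∈
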